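{- Let $\Gamma$ be a graph satisfying (P) and (N), let $\mathbb{H}$ be a $\{2,3\}$-hypergraph on $\mathfrak{C}(\Gamma)$ satisfying (E), and fix isomorphisms $\varphi_C:P_{v(C)}\to C$ for $C\in\mathfrak{C}(\Gamma)$. Let $C\in\mathfrak{C}_{\rm odd}(\Gamma)\setminus\mathfrak{C}_1(\Gamma)$. Then: 1. $V(\Gamma\bullet\mathbb{H})\setminus\{\varphi_C(0),\varphi_C(1)\}$ is a module of $(\Gamma\bullet\mathbb{H})-\varphi_C(0)$; 2. $V(\Gamma\bullet\mathbb{H})\setminus\{\varphi_C(2w(C)-1),\varphi_C(2w(C))\}$ is a module of $(\Gamma\bullet\mathbb{H})-\varphi_C(2w(C))$; 3. if $w(C)\geq1$, then for each $m\in\{1,\ldots,2w(C)-1\}$, $\{\varphi_C(m-1),\varphi_C(m+1)\}$ is a module of $(\Gamma\bullet\mathbb{H})-\varphi_C(m)$.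
   Context: All structures are finite. A hypergraph $H$ has vertex set $V(H)$ and edge set $E(H)\subseteq 2^{V(H)}\setminus\{\emptyset\}$; $v(H)=|V(H)|$; 3-hypergraph: all edges have 3 elements; $\{2,3\}$-hypergraph: all edges have 2 or 3 elements. $H-X$ is the induced subhypergraph on $V(H)\setminus X$ (edges contained in it), $H-v=H-\{v\}$. $M\subseteq V(H)$ is a module if for each $e\in E(H)$ with $e\cap M\neq\emptyset$, $e\setminus M\neq\emptyset$ there is $m\in M$ with $e\cap M=\{m\}$ and $(e\setminus\{m\})\cup\{n\}\in E(H)$ for all $n\in M$. For a tournament $T$, $C_3(T)$ is the 3-hypergraph on $V(T)$ whose edges are the 3-sets inducing a 3-cycle. $L_m$: tournament on $\{0,\dots,m-1\}$ with arcs $ij$ for $i<j$; $U_{2n+1}$: obtained from $L_{2n+1}$ by reversing all arcs between two even vertices. Construction. $P_n$ is the path on $\{0,\ldots,n-1\}$ with edges $\{k,k+1\}$. For a graph $\Gamma$: $\mathfrak{C}(\Gamma)$ its components; $\mathfrak{C}_{\rm even}(\Gamma)$, $\mathfrak{C}_{\rm odd}(\Gamma)$ those with even/odd number of vertices; $\mathfrak{C}_1(\Gamma)$ the one-vertex components; $w(C)=\lfloor v(C)/2\rfloor$. (P): every component is a path. (N): $\mathfrak{C}(\Gamma)\setminus\mathfrak{C}_1(\Gamma)\neq\emptyset$; for each odd $C$, if $V(\Gamma)\setminus V(C)\neq\emptyset$ then $(\mathfrak{C}(\Gamma)\setminus\mathfrak{C}_1(\Gamma))\setminus\{C\}\neq\emptyset$;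 for each even $C$, if $|V(\Gamma)\setminus V(C)|\ge2$ then $(\mathfrak{C}(\Gamma)\setminus\mathfrak{C}_1(\Gamma))\setminus\{C\}\neq\emptyset$. (E): each 2-element edge of $\mathbb{H}$ contains one even and one odd component; each 3-element edge consists of odd components. $\Gamma\bullet\mathbb{H}$ is the 3-hypergraph on $V(\Gamma)$ whose edge set is the union of: (i) for each $C\in\mathfrak{C}_{\rm odd}(\Gamma)\setminus\mathfrak{C}_1(\Gamma)$, $\varphi_C(E(C_3(U_{v(C)})))$; (ii) for each edge $\{C,D\}$ of $\mathbb{H}$, $C$ even, $D$ odd, the sets $\{\varphi_C(2i),\varphi_C(2j+1),\varphi_D(2k)\}$, $0\le i\le j\le w(C)-1$, $0\le k\le w(D)$; (iii) for each edge $\{I,J,K\}$ of $\mathbb{H}$, the sets $\{\varphi_I(2i),\varphi_J(2j),\varphi_K(2k)\}$, $0\le i\le w(I)$, $0\le j\le w(J)$, $0\le k\le w(K)$. -}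

module Defs where

open import Data.Nat using (ℕ; zero; suc; _+_; _*_; _∸_; _≤_; _<_)
open import Data.Nat.Divisibility using (_∣_)
open import Data.Nat.DivMod using (_/_)
open import Data.Fin using (Fin; toℕ)
open import Data.Fin.Subset using (Subset; _∈_; _∉_; _⊆_; _∩_; _∪_; _─_; _-_; ⁅_⁆; ∣_∣; Nonempty; ⊤)
open import Data.Product using (Σ; ∃; ∃-syntax; _×_; _,_)
open import Data.Sum using (_⊎_)
open import Relation.Nullary using (¬_)
open import Relation.Binary.PropositionalEquality using (_≡_; _≢_)
open import Function.Bundles using (_⇔_)

Even : ℕ → Set
Even m = 2 ∣ m

Odd : ℕ → Set
Odd m = ¬ (2 ∣ m)

-- w(C) = ⌊ v(C) / 2 ⌋, applied to the number of vertices
w : ℕ → ℕ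
w m = m / 2

record Hypergraph (n : ℕ) : Set₁ where
  field
    V : Subset n
    E : Subset n → Set
open Hypergraph public

WellFormed : ∀ {n} → Hypergraph n → Set
WellFormed H = ∀ e → E H e → Nonempty e × e ⊆ V H

_∖ₕ_ : ∀ {n} → Hypergraph n → Subset n → Hypergraph n
H ∖ₕ X = record { V = V H ─ X ; E = λ e → E H e × e ⊆ (V H ─ X) }

_-ᵥ_ : ∀ {n} → Hypergraph n → Fin n → Hypergraph n
H -ᵥ v = H ∖ₕ ⁅ v ⁆

IsModule : ∀ {n} → Hypergraph n → Subset n → Set
IsModule H M =
  M ⊆ V H ×
  (∀ e → E H e → Nonempty (e ∩ M) → Nonempty (e ─ M) →
     ∃[ m ] (m ∈ M × e ∩ M ≡ ⁅ m ⁆ ×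
             (∀ n′ → n′ ∈ M → E H ((e - m) ∪ ⁅ n′ ⁆))))

L-arc : ℕ → ℕ → ℕ → Set
L-arc m i j = i < j × j < m

U-arc : ℕ → ℕ → ℕ → Set
U-arc m i j =
  (L-arc m i j × ¬ (Even i × Even j)) ⊎ (L-arc m j i × Even i × Even j)

Cyc3 : (ℕ → ℕ → Set) → ℕ → ℕ → ℕ → Set
Cyc3 A a b c = A a b × A b c × A c a

record Graph (n : ℕ) : Set₁ where
  field
    Adj : Fin n → Fin n → Set
    sym : ∀ x y → Adj x y → Adj y x
    irrefl : ∀ x → ¬ Adj x x
open Graph public

data Reach {n} (Γ : Graph n) : Fin n → Fin n → Set where
  here : ∀ x → Reach Γ x x
  step : ∀ x y z → Adj Γ x y → Reach Γ y z → Reach Γ x z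

PAdj : ∀ {k} → Fin k → Fin k → Set
PAdj a b = toℕ b ≡ suc (toℕ a) ⊎ toℕ a ≡ suc (toℕ b)

-- An enumeration of the components of Γ as C_0,…,C_{c-1}, with
-- v(C_i) = size i, together with isomorphisms φ i : P_{size i} → C_i.
record PathComponents {n} (Γ : Graph n) (c : ℕ) : Set where
  field
    size : Fin c → ℕ
    φ : (i : Fin c) → Fin (size i) → Fin n
    size-pos : ∀ i → 1 ≤ size i
    cover : ∀ x → ∃[ i ] ∃[ a ] φ i a ≡ x
    inj : ∀ i j a b → φ i a ≡ φ j b →
          _≡_ {A = Σ (Fin c) (λ k → Fin (size k))} (i , a) (j , b)
    comp : ∀ i j a b → Reach Γ (φ i a) (φ j b) ⇔ (i ≡ j)
    iso : ∀ i a b → Adj Γ (φ i a) (φ i b) ⇔ PAdj a b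
open PathComponents public

module _ {n : ℕ} {Γ : Graph n} {c : ℕ} (K : PathComponents Γ c) where

  InC : Fin c → Fin n → Set
  InC i x = ∃[ a ] φ K i a ≡ x

  NonSingleton : Fin c → Set
  NonSingleton i = ¬ (size K i ≡ 1)

  CondN : Set
  CondN =
    (∃[ D ] NonSingleton D) ×
    (∀ C → Odd (size K C) → (∃[ x ] ¬ InC C x) →
       ∃[ D ] (NonSingleton D × D ≢ C)) ×
    (∀ C → Even (size K C) →
       (∃[ x ] ∃[ y ] (x ≢ y × ¬ InC C x × ¬ InC C y)) →
       ∃[ D ] (NonSingleton D × D ≢ C))

  Is23 : (Subset c → Set) → Set
  Is23 EH = ∀ e → EH e → (∣ e ∣ ≡ 2 ⊎ ∣ e ∣ ≡ 3)

  CondE : (Subset c → Set) → Set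
  CondE EH =
    (∀ e → EH e → ∣ e ∣ ≡ 2 →
       ∃[ C ] ∃[ D ] (C ∈ e × D ∈ e × Even (size K C) × Odd (size K D))) ×
    (∀ e → EH e → ∣ e ∣ ≡ 3 → ∀ C → C ∈ e → Odd (size K C))

  triple : Fin n → Fin n → Fin n → Subset n
  triple x y z = ⁅ x ⁆ ∪ ⁅ y ⁆ ∪ ⁅ z ⁆

  data BulletEdge (EH : Subset c → Set) : Subset n → Set where
    cyc : ∀ C → Odd (size K C) → NonSingleton C →
          (a b d : Fin (size K C)) →
          Cyc3 (U-arc (size K C)) (toℕ a) (toℕ b) (toℕ d) →
          BulletEdge EH (triple (φ K C a) (φ K C b) (φ K C d))
    two : ∀ C D → EH (⁅ C ⁆ ∪ ⁅ D ⁆) → Even (size K C) → Odd (size K D) →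
          (a b : Fin (size K C)) (d : Fin (size K D)) (i j k : ℕ) →
          i ≤ j → j ≤ w (size K C) ∸ 1 → k ≤ w (size K D) →
          toℕ a ≡ 2 * i → toℕ b ≡ 2 * j + 1 → toℕ d ≡ 2 * k →
          BulletEdge EH (triple (φ K C a) (φ K C b) (φ K D d))
    three : ∀ I J L → I ≢ J → J ≢ L → I ≢ L → EH (⁅ I ⁆ ∪ ⁅ J ⁆ ∪ ⁅ L ⁆) →
          (a : Fin (size K I)) (b : Fin (size K J)) (d : Fin (size K L))
          (i j k : ℕ) →
          i ≤ w (size K I) → j ≤ w (size K J) → k ≤ w (size K L) →
          toℕ a ≡ 2 * i → toℕ b ≡ 2 * j → toℕ d ≡ 2 * k →
          BulletEdge EH (triple (φ K I a) (φ K J b) (φ K L d))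

  Bullet : (Subset c → Set) → Hypergraph n
  Bullet EH = record { V = ⊤ ; E = BulletEdge EH }

-- Only edges of type (i) of C pass through a vertex φ_C(j) at an odd position j, and a
-- 3-cycle of U_{v(C)} is a rotation of p < q < r with p, r even and q odd. So an edge through
-- φ_C(1) also contains φ_C(0), the only smaller position, and an edge through φ_C(2w − 1) also
-- contains φ_C(2w), the only larger one. Once that vertex is deleted, no edge leaves the
-- complement of the pair, which is therefore a module (parts 1 and 2).
-- In part 3 an edge avoiding φ_C(m) meets {φ_C(m − 1), φ_C(m + 1)} in one vertex, and
-- exchanging it for the other one gives an edge again: the two positions have the same parity,
-- so they are admissible in edges of types (ii) and (iii) together, and the order constraints
-- of a 3-cycle cannot separate m − 1 from m + 1 without using m itself.

module Submission where

open import Defs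
open import Data.Nat using (ℕ; zero; suc; _+_; _*_; _∸_; _≤_; _<_; z≤n; s≤s)
open import Data.Nat.Properties
  using (+-comm; *-comm; *-suc; *-cancelˡ-≤; n<1⇒n≡0; n<1+n; 1+n≢n; n≤1+n; ≤-antisym; ≤-pred;
         ≤-trans; <-trans; <-irrefl; ≤∧≢⇒<; <⇒≢)
open import Data.Nat.Divisibility
  using (_∣_; divides; ∣1⇒≡1; ∣m∣n⇒∣m+n; ∣m+n∣m⇒∣n; ∣-refl; m∣m*n; m%n≡0⇒n∣m)
open import Data.Nat.DivMod using (_/_; _%_; m%n<n; m≡m%n+[m/n]*n)
open import Data.Fin using (Fin; toℕ)
open import Data.Fin.Properties using (toℕ-injective)
open import Data.Fin.Subset
  using (Subset; _∈_; _∉_; _⊆_; _∩_; _∪_; _─_; _-_; ⁅_⁆; Nonempty; ⊤; outside)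
open import Data.Fin.Subset.Properties
  using (x∈⁅x⁆; x∈⁅y⁆⇒x≡y; ⊆-antisym; x∈p∩q⁺; x∈p∩q⁻; x∈p∪q⁻; x∈p∪q⁺; x∈p∧x∉q⇒x∈p─q;
         p─q⊆p; _∈?_; ∈⊤; ∪-comm; ∪-assoc)
open import Data.List using (List; []; _∷_)
open import Data.List.Membership.Propositional using () renaming (_∈_ to _∈ₗ_)
open import Data.List.Membership.Propositional.Properties using (∈-map⁺; ∈-map⁻)
open import Data.List.Relation.Unary.Any using (here; there)
open import Data.Vec using (_∷_)
import Data.Vec as Vec
open import Data.Product using (∃-syntax; _×_; _,_; proj₁)
import Data.Product as Product
open import Data.Sum using (_⊎_; inj₁; inj₂)
open import Data.Empty using (⊥; ⊥-elim)
open import Function using (_∘_)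
open import Relation.Nullary using (¬_; yes; no)
open import Relation.Binary.PropositionalEquality as ≡ using (_≡_; _≢_; refl; trans; cong; subst)

¬even-1 : ¬ Even 1
¬even-1 2∣1 with () ← ∣1⇒≡1 2∣1

even-double : ∀ k → Even (2 * k)
even-double k = m∣m*n k

even-2+ : ∀ {m} → Even m → Even (2 + m)
even-2+ = ∣m∣n⇒∣m+n ∣-refl

even-2+⁻ : ∀ {m} → Even (2 + m) → Even m
even-2+⁻ 2∣2+m = ∣m+n∣m⇒∣n 2∣2+m ∣-refl

even⇒odd-suc : ∀ {m} → Even m → Odd (suc m)
even⇒odd-suc {m} 2∣m 2∣1+m = ¬even-1 (∣m+n∣m⇒∣n (subst (2 ∣_) (+-comm 1 m) 2∣1+m) 2∣m)

odd⇒≡1+2*w : ∀ s → Odd s → s ≡ suc (2 * w s)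
odd⇒≡1+2*w s odd with s % 2 | m%n<n s 2 | m≡m%n+[m/n]*n s 2 | m%n≡0⇒n∣m s 2
... | 0           | _            | _  | 2∣s = ⊥-elim (odd (2∣s refl))
... | 1           | _            | s≡ | _   = trans s≡ (cong suc (*-comm (s / 2) 2))
... | suc (suc _) | s≤s (s≤s ()) | _  | _

1+2*W≢1⇒1≤W : ∀ {W} → suc (2 * W) ≢ 1 → 1 ≤ W
1+2*W≢1⇒1≤W {zero}  1≢1 = ⊥-elim (1≢1 refl)
1+2*W≢1⇒1≤W {suc _} _   = s≤s z≤n

suc[2*W∸1]≡2*W : ∀ W → 1 ≤ W → suc (2 * W ∸ 1) ≡ 2 * W
suc[2*W∸1]≡2*W (suc _) _ = refl

2*W∸1-odd : ∀ W → 1 ≤ W → Odd (2 * W ∸ 1)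
2*W∸1-odd W 1≤W even = even⇒odd-suc even (subst Even (≡.sym (suc[2*W∸1]≡2*W W 1≤W)) (even-double W))

EvenOddEven : ℕ → ℕ → ℕ → ℕ → Set
EvenOddEven s p q r = Even p × Odd q × Even r × p < q × q < r × r < s

U-cycle-rotate : ∀ {s x y z} → Cyc3 (U-arc s) x y z → Cyc3 (U-arc s) y z x
U-cycle-rotate (xy , yz , zx) = yz , zx , xy

U-cycle⇒EvenOddEven : ∀ {s x y z} → Cyc3 (U-arc s) x y z →
  EvenOddEven s x y z ⊎ EvenOddEven s y z x ⊎ EvenOddEven s z x y
U-cycle⇒EvenOddEven (inj₁ ((x<y , _) , _) , inj₁ ((y<z , _) , _) , inj₁ ((z<x , _) , _)) =
  ⊥-elim (<-irrefl refl (<-trans x<y (<-trans y<z z<x)))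
U-cycle⇒EvenOddEven (inj₁ ((x<y , _) , ¬xy) , inj₁ ((y<z , z<s) , _) , inj₂ (_ , ez , ex)) =
  inj₁ (ex , (λ ey → ¬xy (ex , ey)) , ez , x<y , y<z , z<s)
U-cycle⇒EvenOddEven (inj₂ ((y<x , x<s) , ex , ey) , inj₁ ((y<z , _) , ¬yz) , inj₁ ((z<x , _) , _)) =
  inj₂ (inj₁ (ey , (λ ez → ¬yz (ey , ez)) , ex , y<z , z<x , x<s))
U-cycle⇒EvenOddEven (inj₁ ((x<y , y<s) , _) , inj₂ (_ , ey , ez) , inj₁ ((z<x , _) , ¬zx)) =
  inj₂ (inj₂ (ez , (λ ex → ¬zx (ez , ex)) , ey , z<x , x<y , y<s))
U-cycle⇒EvenOddEven (inj₁ (_ , ¬xy) , inj₂ (_ , ey , _) , inj₂ (_ , _ , ex)) = ⊥-elim (¬xy (ex , ey))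
U-cycle⇒EvenOddEven (inj₂ (_ , _ , ey) , inj₁ (_ , ¬yz) , inj₂ (_ , ez , _)) = ⊥-elim (¬yz (ey , ez))
U-cycle⇒EvenOddEven (inj₂ (_ , ex , _) , inj₂ (_ , _ , ez) , inj₁ (_ , ¬zx)) = ⊥-elim (¬zx (ez , ex))
U-cycle⇒EvenOddEven (inj₂ ((y<x , _) , _) , inj₂ ((z<y , _) , _) , inj₂ ((x<z , _) , _)) =
  ⊥-elim (<-irrefl refl (<-trans y<x (<-trans x<z z<y)))

EvenOddEven⇒U-cycle : ∀ {s p q r} → EvenOddEven s p q r → Cyc3 (U-arc s) p q r
EvenOddEven⇒U-cycle (ep , oq , er , p<q , q<r , r<s) =
  inj₁ ((p<q , <-trans q<r r<s) , λ (_ , eq) → oq eq) ,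
  inj₁ ((q<r , r<s) , λ (eq , _) → oq eq) ,
  inj₂ ((<-trans p<q q<r , r<s) , er , ep)

∈-rotate : ∀ {A : Set} {v x y z : A} → v ∈ₗ x ∷ y ∷ z ∷ [] → v ∈ₗ y ∷ z ∷ x ∷ []
∈-rotate (here v≡x)                 = there (there (here v≡x))
∈-rotate (there (here v≡y))         = here v≡y
∈-rotate (there (there (here v≡z))) = there (here v≡z)

Around : ℕ → ℕ → List ℕ → Set
Around s u xs = (∃[ p ] (p ∈ₗ xs × p < u)) × (∃[ r ] (r ∈ₗ xs × u < r × r < s))

Around-mono : ∀ {s u xs ys} → (∀ {v} → v ∈ₗ xs → v ∈ₗ ys) → Around s u xs → Around s u ys
Around-mono xs⊆ys = Product.map (Product.map₂ (Product.map₁ xs⊆ys))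
                                (Product.map₂ (Product.map₁ xs⊆ys))

EvenOddEven-around : ∀ {s p q r u} → EvenOddEven s p q r → u ∈ₗ p ∷ q ∷ r ∷ [] → Odd u →
                     Around s u (p ∷ q ∷ r ∷ [])
EvenOddEven-around (ep , _ , _ , _ , _ , _) (here refl) ou = ⊥-elim (ou ep)
EvenOddEven-around (_ , _ , _ , p<q , q<r , r<s) (there (here refl)) _ =
  (_ , here refl , p<q) , (_ , there (there (here refl)) , q<r , r<s)
EvenOddEven-around (_ , _ , er , _ , _ , _) (there (there (here refl))) ou = ⊥-elim (ou er)

U-cycle-around-odd : ∀ {s x y z u} → Cyc3 (U-arc s) x y z → u ∈ₗ x ∷ y ∷ z ∷ [] → Odd u →
                     Around s u (x ∷ y ∷ z ∷ [])
U-cycle-around-odd cy u∈ ou with U-cycle⇒EvenOddEven cy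
... | inj₁ xyz        = EvenOddEven-around xyz u∈ ou
... | inj₂ (inj₁ yzx) = Around-mono (∈-rotate ∘ ∈-rotate) (EvenOddEven-around yzx (∈-rotate u∈) ou)
... | inj₂ (inj₂ zxy) = Around-mono ∈-rotate (EvenOddEven-around zxy (∈-rotate (∈-rotate u∈)) ou)

U-cycle∋1⇒∋0 : ∀ {s x y z} → Cyc3 (U-arc s) x y z → 1 ∈ₗ x ∷ y ∷ z ∷ [] → 0 ∈ₗ x ∷ y ∷ z ∷ []
U-cycle∋1⇒∋0 cy 1∈ with (p , p∈ , p<1) , _ ← U-cycle-around-odd cy 1∈ ¬even-1 =
  subst (_∈ₗ _) (n<1⇒n≡0 p<1) p∈

U-cycle∋2*W∸1⇒∋2*W : ∀ {s W x y z} → s ≡ suc (2 * W) → 1 ≤ W → Cyc3 (U-arc s) x y z →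
                      2 * W ∸ 1 ∈ₗ x ∷ y ∷ z ∷ [] → 2 * W ∈ₗ x ∷ y ∷ z ∷ []
U-cycle∋2*W∸1⇒∋2*W {W = W} refl 1≤W cy u∈
  with _ , (r , r∈ , u<r , r<1+2W) ← U-cycle-around-odd cy u∈ (2*W∸1-odd W 1≤W) =
  subst (_∈ₗ _) (≤-antisym (≤-pred r<1+2W) (subst (_≤ r) (suc[2*W∸1]≡2*W W 1≤W) u<r)) r∈

positions-through : ∀ {s u v} {a b : Fin s} → toℕ a ≡ v → toℕ b ≡ u →
  (∀ {x y z} → Cyc3 (U-arc s) x y z → u ∈ₗ x ∷ y ∷ z ∷ [] → v ∈ₗ x ∷ y ∷ z ∷ []) →
  ∀ {x y z : Fin s} → Cyc3 (U-arc s) (toℕ x) (toℕ y) (toℕ z) →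
  b ∈ₗ x ∷ y ∷ z ∷ [] → a ∈ₗ x ∷ y ∷ z ∷ []
positions-through a≡v b≡u through cy b∈
  with a′ , a′∈ , v≡a′ ← ∈-map⁻ toℕ (through cy (subst (_∈ₗ _) b≡u (∈-map⁺ toℕ b∈))) =
  subst (_∈ₗ _) (toℕ-injective (≡.sym (trans a≡v v≡a′))) a′∈

t<2+t : ∀ t → t < 2 + t
t<2+t t = n≤1+n (suc t)

Ends : ℕ → ℕ → Set
Ends t x = x ≡ t ⊎ x ≡ 2 + t

ends-elim : ∀ {P : ℕ → Set} {t x} → P t → P (2 + t) → Ends t x → P x
ends-elim Pt _ (inj₁ refl) = Pt
ends-elim _ P2+t (inj₂ refl) = P2+t

below-ends : ∀ {t x} → x < t → ¬ Ends t x
below-ends x<t (inj₁ refl) = <⇒≢ x<t refl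
below-ends {t} x<t (inj₂ refl) = <⇒≢ (<-trans x<t (t<2+t t)) refl

above-ends : ∀ {t x} → 2 + t < x → ¬ Ends t x
above-ends {t} 2+t<x (inj₁ refl) = <⇒≢ (<-trans (t<2+t t) 2+t<x) refl
above-ends 2+t<x (inj₂ refl) = <⇒≢ 2+t<x refl

ends-≢-middle : ∀ {t x} → Ends t x → x ≢ suc t
ends-≢-middle (inj₁ refl) = <⇒≢ (n<1+n _)
ends-≢-middle (inj₂ refl) = 1+n≢n

ends-even : ∀ {t x} → Ends t x → Even x → Even t
ends-even (inj₁ refl) even = even
ends-even (inj₂ refl) even = even-2+⁻ even

ends-double : ∀ {t W} → Even t → 2 + t ≤ 2 * W → ∀ {x} → Ends t x → ∃[ k ] (x ≡ 2 * k × k ≤ W)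
ends-double {t} {W} (divides k t≡k*2) 2+t≤2W = half
  where
  t≡2k : t ≡ 2 * k
  t≡2k = trans t≡k*2 (*-comm k 2)
  2+t≡2[1+k] : 2 + t ≡ 2 * suc k
  2+t≡2[1+k] = trans (cong (2 +_) t≡2k) (≡.sym (*-suc 2 k))
  1+k≤W : suc k ≤ W
  1+k≤W = *-cancelˡ-≤ 2 (subst (_≤ 2 * W) 2+t≡2[1+k] 2+t≤2W)
  half : ∀ {x} → Ends t x → ∃[ k ] (x ≡ 2 * k × k ≤ W)
  half (inj₁ refl) = k , t≡2k , ≤-trans (n≤1+n k) 1+k≤W
  half (inj₂ refl) = suc k , 2+t≡2[1+k] , 1+k≤W

skip-up : ∀ {t h} → t < h → h ≢ suc t → h ≢ 2 + t → 2 + t < h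
skip-up t<h h≢1+t h≢2+t = ≤∧≢⇒< (≤∧≢⇒< t<h (h≢1+t ∘ ≡.sym)) (h≢2+t ∘ ≡.sym)

skip-down : ∀ {t l} → l < 2 + t → l ≢ suc t → l ≢ t → l < t
skip-down l<2+t l≢1+t l≢t = ≤∧≢⇒< (≤-pred (≤∧≢⇒< (≤-pred l<2+t) l≢1+t)) l≢t

even≢odd : ∀ {x y} → Even x → Odd y → x ≢ y
even≢odd ex oy refl = oy ex

replace-first : ∀ {s t p q r} → EvenOddEven s p q r → q ≢ suc t → Ends t p →
                 EvenOddEven s t q r × EvenOddEven s (2 + t) q r
replace-first pat@(ep , oq , er , p<q , q<r , r<s) q≢1+t (inj₁ refl) =
  pat , (even-2+ ep , oq , er , skip-up p<q q≢1+t (even≢odd (even-2+ ep) oq ∘ ≡.sym) , q<r , r<s)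
replace-first {t = t} pat@(ep , oq , er , p<q , q<r , r<s) _ (inj₂ refl) =
  (even-2+⁻ ep , oq , er , <-trans (t<2+t t) p<q , q<r , r<s) , pat

replace-middle : ∀ {s t p q r} → EvenOddEven s p q r → p ≢ suc t → r ≢ suc t → Ends t q →
                  EvenOddEven s p t r × EvenOddEven s p (2 + t) r
replace-middle {t = t} pat@(ep , oq , er , p<q , q<r , r<s) _ r≢1+t (inj₁ refl) =
  pat , (ep , oq ∘ even-2+⁻ , er , <-trans p<q (t<2+t t) ,
         skip-up q<r r≢1+t (even≢odd er (oq ∘ even-2+⁻)) , r<s)
replace-middle {t = t} pat@(ep , oq , er , p<q , q<r , r<s) p≢1+t _ (inj₂ refl) =
  (ep , oq ∘ even-2+ , er , skip-down p<q p≢1+t (even≢odd ep (oq ∘ even-2+)) ,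
   <-trans (t<2+t t) q<r , r<s) , pat

replace-last : ∀ {s t p q r} → EvenOddEven s p q r → q ≢ suc t → 2 + t < s → Ends t r →
                EvenOddEven s p q t × EvenOddEven s p q (2 + t)
replace-last {t = t} pat@(ep , oq , er , p<q , q<r , r<s) _ 2+t<s (inj₁ refl) =
  pat , (ep , oq , even-2+ er , p<q , <-trans q<r (t<2+t t) , 2+t<s)
replace-last {t = t} pat@(ep , oq , er , p<q , q<r , r<s) q≢1+t _ (inj₂ refl) =
  (ep , oq , even-2+⁻ er , p<q , skip-down q<r q≢1+t (even≢odd (even-2+⁻ er) oq ∘ ≡.sym) ,
   <-trans (t<2+t t) r<s) , pat

exchange-first : ∀ {s t p q r} → EvenOddEven s p q r → q ≢ suc t → Ends t p →
                 (∀ {x} → Ends t x → EvenOddEven s x q r) × ¬ Ends t q × ¬ Ends t r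
exchange-first {s} {q = q} {r} pat q≢1+t ends
  with pat-t , pat-2+t@(_ , _ , _ , 2+t<q , q<r , _) ← replace-first pat q≢1+t ends =
  ends-elim {P = λ x → EvenOddEven s x q r} pat-t pat-2+t ,
  above-ends 2+t<q , above-ends (<-trans 2+t<q q<r)

exchange-middle : ∀ {s t p q r} → EvenOddEven s p q r → p ≢ suc t → r ≢ suc t → Ends t q →
                  (∀ {x} → Ends t x → EvenOddEven s p x r) × ¬ Ends t p × ¬ Ends t r
exchange-middle {s} {p = p} {r = r} pat p≢1+t r≢1+t ends
  with pat-t@(_ , _ , _ , p<t , _) , pat-2+t@(_ , _ , _ , _ , 2+t<r , _) ← replace-middle pat p≢1+t r≢1+t ends =
  ends-elim {P = λ x → EvenOddEven s p x r} pat-t pat-2+t ,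
  below-ends p<t , above-ends 2+t<r

exchange-last : ∀ {s t p q r} → EvenOddEven s p q r → q ≢ suc t → 2 + t < s → Ends t r →
                (∀ {x} → Ends t x → EvenOddEven s p q x) × ¬ Ends t p × ¬ Ends t q
exchange-last {s} {p = p} {q} pat q≢1+t 2+t<s ends
  with pat-t@(_ , _ , _ , p<q , q<t , _) , pat-2+t ← replace-last pat q≢1+t 2+t<s ends =
  ends-elim {P = λ x → EvenOddEven s p q x} pat-t pat-2+t ,
  below-ends (<-trans p<q q<t) , below-ends q<t

x∈p─q⇒x∉q : ∀ {n} (p q : Subset n) {x} → x ∈ p ─ q → x ∉ q
x∈p─q⇒x∉q (_ ∷ p) (outside ∷ q) Vec.here ()
x∈p─q⇒x∉q (_ ∷ p) (_ ∷ q) (Vec.there x∈p─q) (Vec.there x∈q) = x∈p─q⇒x∉q p q x∈p─q x∈q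

module _ {n : ℕ} where

  ∈-pair⁻ : ∀ {x u v : Fin n} → x ∈ ⁅ u ⁆ ∪ ⁅ v ⁆ → x ≡ u ⊎ x ≡ v
  ∈-pair⁻ {u = u} {v} x∈ with x∈p∪q⁻ ⁅ u ⁆ ⁅ v ⁆ x∈
  ... | inj₁ x∈u = inj₁ (x∈⁅y⁆⇒x≡y u x∈u)
  ... | inj₂ x∈v = inj₂ (x∈⁅y⁆⇒x≡y v x∈v)

  ∈-pair⁺ : ∀ {x u v : Fin n} → x ≡ u ⊎ x ≡ v → x ∈ ⁅ u ⁆ ∪ ⁅ v ⁆
  ∈-pair⁺ (inj₁ refl) = x∈p∪q⁺ (inj₁ (x∈⁅x⁆ _))
  ∈-pair⁺ (inj₂ refl) = x∈p∪q⁺ (inj₂ (x∈⁅x⁆ _))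

  ∈-triple⁻ : ∀ {x u v w : Fin n} → x ∈ ⁅ u ⁆ ∪ ⁅ v ⁆ ∪ ⁅ w ⁆ → x ∈ₗ u ∷ v ∷ w ∷ []
  ∈-triple⁻ {u = u} x∈ with x∈p∪q⁻ ⁅ u ⁆ _ x∈
  ... | inj₁ x∈u = here (x∈⁅y⁆⇒x≡y u x∈u)
  ... | inj₂ x∈vw with ∈-pair⁻ x∈vw
  ...   | inj₁ x≡v = there (here x≡v)
  ...   | inj₂ x≡w = there (there (here x≡w))

  ∈-triple⁺ : ∀ {x u v w : Fin n} → x ∈ₗ u ∷ v ∷ w ∷ [] → x ∈ ⁅ u ⁆ ∪ ⁅ v ⁆ ∪ ⁅ w ⁆
  ∈-triple⁺ (here refl)                 = x∈p∪q⁺ (inj₁ (x∈⁅x⁆ _))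
  ∈-triple⁺ (there (here x≡v))         = x∈p∪q⁺ (inj₂ (∈-pair⁺ (inj₁ x≡v)))
  ∈-triple⁺ (there (there (here x≡w))) = x∈p∪q⁺ (inj₂ (∈-pair⁺ (inj₂ x≡w)))

  triple-rotate : ∀ (u v w : Fin n) → ⁅ u ⁆ ∪ ⁅ v ⁆ ∪ ⁅ w ⁆ ≡ ⁅ v ⁆ ∪ ⁅ w ⁆ ∪ ⁅ u ⁆
  triple-rotate u v w = trans (∪-comm ⁅ u ⁆ _) (∪-assoc ⁅ v ⁆ ⁅ w ⁆ ⁅ u ⁆)

  ∪-∩-singleton : ∀ {p : Fin n} {R M} → p ∈ M → (∀ {x} → x ∈ R → x ∉ M) →
                  (⁅ p ⁆ ∪ R) ∩ M ≡ ⁅ p ⁆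
  ∪-∩-singleton {p} {R} {M} p∈M R∩M=∅ = ⊆-antisym ⊆⁅p⁆ ⁅p⁆⊆
    where
    ⊆⁅p⁆ : (⁅ p ⁆ ∪ R) ∩ M ⊆ ⁅ p ⁆
    ⊆⁅p⁆ x∈ with x∈p∩q⁻ (⁅ p ⁆ ∪ R) M x∈
    ... | x∈pR , x∈M with x∈p∪q⁻ ⁅ p ⁆ R x∈pR
    ...   | inj₁ x∈p = x∈p
    ...   | inj₂ x∈R = ⊥-elim (R∩M=∅ x∈R x∈M)
    ⁅p⁆⊆ : ⁅ p ⁆ ⊆ (⁅ p ⁆ ∪ R) ∩ M
    ⁅p⁆⊆ x∈p with refl ← x∈⁅y⁆⇒x≡y p x∈p = x∈p∩q⁺ (x∈p∪q⁺ (inj₁ x∈p) , p∈M)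

  ∪-─-singleton : ∀ {p : Fin n} {R} → p ∉ R → (⁅ p ⁆ ∪ R) - p ≡ R
  ∪-─-singleton {p} {R} p∉R = ⊆-antisym ⊆R R⊆
    where
    ⊆R : (⁅ p ⁆ ∪ R) - p ⊆ R
    ⊆R x∈ with x∈p∪q⁻ ⁅ p ⁆ R (p─q⊆p _ ⁅ p ⁆ x∈)
    ... | inj₁ x∈p = ⊥-elim (x∈p─q⇒x∉q _ ⁅ p ⁆ x∈ x∈p)
    ... | inj₂ x∈R = x∈R
    R⊆ : R ⊆ (⁅ p ⁆ ∪ R) - p
    R⊆ x∈R = x∈p∧x∉q⇒x∈p─q (x∈p∪q⁺ (inj₂ x∈R))
               (λ x∈p → p∉R (subst (_∈ R) (x∈⁅y⁆⇒x≡y p x∈p) x∈R))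

Exchangeable : ∀ {n} → (Subset n → Set) → Subset n → Subset n → Set
Exchangeable P M e =
  ∃[ p ] ∃[ R ] (e ≡ ⁅ p ⁆ ∪ R × p ∈ M × (∀ {x} → x ∈ R → x ∉ M) ×
                 (∀ {x} → x ∈ M → P (⁅ x ⁆ ∪ R)))

exchangeable⇒module : ∀ {n} (H : Hypergraph n) (X M : Subset n) → M ⊆ V H ─ X →
  (∀ {e} → E H e → e ⊆ V H ─ X → Nonempty (e ∩ M) → Exchangeable (E H) M e) →
  IsModule (H ∖ₕ X) M
exchangeable⇒module H X M M⊆ exchangeable =
  M⊆ , λ e (Ee , e⊆) e∩M≠∅ _ → witness (exchangeable Ee e⊆ e∩M≠∅) e⊆
  where
  witness : ∀ {e} → Exchangeable (E H) M e → e ⊆ V H ─ X →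
            ∃[ m ] (m ∈ M × e ∩ M ≡ ⁅ m ⁆ × ∀ x → x ∈ M → E (H ∖ₕ X) ((e - m) ∪ ⁅ x ⁆))
  witness (p , R , refl , p∈M , R∩M=∅ , swap) e⊆ =
    p , p∈M , ∪-∩-singleton p∈M R∩M=∅ , λ x x∈M →
      subst (E (H ∖ₕ X)) (≡.sym (replaced x)) (swap x∈M , x∪R⊆ x∈M)
    where
    replaced : ∀ x → ((⁅ p ⁆ ∪ R) - p) ∪ ⁅ x ⁆ ≡ ⁅ x ⁆ ∪ R
    replaced x = trans (cong (_∪ ⁅ x ⁆) (∪-─-singleton (λ p∈R → R∩M=∅ p∈R p∈M))) (∪-comm R ⁅ x ⁆)
    x∪R⊆ : ∀ {x} → x ∈ M → ⁅ x ⁆ ∪ R ⊆ V H ─ X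
    x∪R⊆ {x} x∈M y∈ with x∈p∪q⁻ ⁅ x ⁆ R y∈
    ... | inj₁ y∈x with refl ← x∈⁅y⁆⇒x≡y x y∈x = M⊆ x∈M
    ... | inj₂ y∈R = e⊆ (x∈p∪q⁺ (inj₂ y∈R))

complement-module : ∀ {n} (H : Hypergraph n) (u v : Fin n) → (∀ {e} → E H e → v ∈ e → u ∈ e) →
                    IsModule (H -ᵥ u) (V H ─ (⁅ u ⁆ ∪ ⁅ v ⁆))
complement-module H u v v⇒u = M⊆ , λ e (Ee , e⊆) _ (x , x∈) → ⊥-elim (no-outside Ee e⊆ x∈)
  where
  M⊆ : V H ─ (⁅ u ⁆ ∪ ⁅ v ⁆) ⊆ V H ─ ⁅ u ⁆
  M⊆ x∈ = x∈p∧x∉q⇒x∈p─q (p─q⊆p _ _ x∈) (λ x∈u → x∈p─q⇒x∉q _ _ x∈ (x∈p∪q⁺ (inj₁ x∈u)))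
  no-outside : ∀ {e x} → E H e → e ⊆ V H ─ ⁅ u ⁆ → x ∈ e ─ (V H ─ (⁅ u ⁆ ∪ ⁅ v ⁆)) → ⊥
  no-outside {e} {x} Ee e⊆ x∈ with x ∈? (⁅ u ⁆ ∪ ⁅ v ⁆)
  ... | no x∉uv = x∈p─q⇒x∉q e _ x∈ (x∈p∧x∉q⇒x∈p─q (p─q⊆p _ _ (e⊆ (p─q⊆p e _ x∈))) x∉uv)
  ... | yes x∈uv with ∈-pair⁻ x∈uv
  ...   | inj₁ refl = x∈p─q⇒x∉q _ _ (e⊆ (p─q⊆p e _ x∈)) (x∈⁅x⁆ u)
  ...   | inj₂ refl = x∈p─q⇒x∉q _ _ (e⊆ (v⇒u Ee (p─q⊆p e _ x∈))) (x∈⁅x⁆ u)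

module _ {n c : ℕ} {Γ : Graph n} (K : PathComponents Γ c) where

  component-of : ∀ {i j x y} → φ K i x ≡ φ K j y → i ≡ j
  component-of {i} {j} {x} {y} eq = cong proj₁ (inj K i j x y eq)

  φ-injective : ∀ {i x y} → φ K i x ≡ φ K i y → x ≡ y
  φ-injective {i} {x} {y} eq with refl ← inj K i i x y eq = refl

  even-size : ∀ {i j x y} → φ K i x ≡ φ K j y → Even (size K j) → Even (size K i)
  even-size eq = subst (Even ∘ size K) (≡.sym (component-of eq))

  even-position : ∀ {i j x y} k → φ K i x ≡ φ K j y → toℕ y ≡ 2 * k → Even (toℕ x)
  even-position {i} {j} {x} {y} k eq y≡2k with refl ← inj K i j x y eq =
    subst Even (≡.sym y≡2k) (even-double k)

module _ {n c : ℕ} {Γ : Graph n} (K : PathComponents Γ c) (EH : Subset c → Set) where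

  cycles-through⇒edges-through : ∀ {C} {a b : Fin (size K C)} → Odd (size K C) → Odd (toℕ b) →
    (∀ {x y z} → Cyc3 (U-arc (size K C)) (toℕ x) (toℕ y) (toℕ z) →
                 b ∈ₗ x ∷ y ∷ z ∷ [] → a ∈ₗ x ∷ y ∷ z ∷ []) →
    ∀ {e} → BulletEdge K EH e → φ K C b ∈ e → φ K C a ∈ e
  cycles-through⇒edges-through {C} {a} {b} _ _ through (cyc C′ _ _ x y z cy) b∈
    with ∈-map⁻ (φ K C′) {xs = x ∷ y ∷ z ∷ []} (∈-triple⁻ b∈)
  ... | b′ , b′∈ , φb≡φb′ with refl ← inj K C C′ b b′ φb≡φb′ = ∈-triple⁺ (∈-map⁺ (φ K C) (through cy b′∈))
  cycles-through⇒edges-through oddC oddb _ (two _ _ _ evenC′ _ _ _ _ _ _ k _ _ _ _ _ d≡2k) b∈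
    with ∈-triple⁻ b∈
  ... | here eq                 = ⊥-elim (oddC (even-size K eq evenC′))
  ... | there (here eq)         = ⊥-elim (oddC (even-size K eq evenC′))
  ... | there (there (here eq)) = ⊥-elim (oddb (even-position K k eq d≡2k))
  cycles-through⇒edges-through _ oddb _ (three _ _ _ _ _ _ _ _ _ _ i j k _ _ _ a≡2i b≡2j d≡2k) b∈
    with ∈-triple⁻ b∈
  ... | here eq                 = ⊥-elim (oddb (even-position K i eq a≡2i))
  ... | there (here eq)         = ⊥-elim (oddb (even-position K j eq b≡2j))
  ... | there (there (here eq)) = ⊥-elim (oddb (even-position K k eq d≡2k))

-- Positions t, 1 + t, 2 + t are the paper's m − 1, m, m + 1.
module Neighbours {n c : ℕ} {Γ : Graph n} (K : PathComponents Γ c) (EH : Subset c → Set)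
              {C : Fin c} (oddC : Odd (size K C)) (t : ℕ) {a b d : Fin (size K C)}
              (a≡t : toℕ a ≡ t) (b≡1+t : toℕ b ≡ suc t) (d≡2+t : toℕ d ≡ 2 + t)
              (2+t≤2w : 2 + t ≤ 2 * w (size K C)) where

  M : Subset n
  M = ⁅ φ K C a ⁆ ∪ ⁅ φ K C d ⁆

  M-elim : ∀ {P : Fin n → Set} → (∀ {y} → Ends t (toℕ y) → P (φ K C y)) → ∀ {x} → x ∈ M → P x
  M-elim P-ends x∈M with ∈-pair⁻ x∈M
  ... | inj₁ refl = P-ends (inj₁ a≡t)
  ... | inj₂ refl = P-ends (inj₂ d≡2+t)

  ∈M⁺ : ∀ {y} → Ends t (toℕ y) → φ K C y ∈ M
  ∈M⁺ (inj₁ y≡t)   = ∈-pair⁺ (inj₁ (cong (φ K C) (toℕ-injective (trans y≡t (≡.sym a≡t)))))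
  ∈M⁺ (inj₂ y≡2+t) = ∈-pair⁺ (inj₂ (cong (φ K C) (toℕ-injective (trans y≡2+t (≡.sym d≡2+t)))))

  ∉M-position : ∀ {y} → ¬ Ends t (toℕ y) → φ K C y ∉ M
  ∉M-position {y} ¬ends φy∈M =
    ¬ends (M-elim {P = λ x → x ≡ φ K C y → Ends t (toℕ y)}
                  (λ ends φy′≡φy → subst (Ends t ∘ toℕ) (φ-injective K φy′≡φy) ends) φy∈M refl)

  ∉M-component : ∀ {C′} {y : Fin (size K C′)} → C′ ≢ C → φ K C′ y ∉ M
  ∉M-component {C′} {y} C′≢C φy∈M =
    C′≢C (≡.sym (M-elim {P = λ x → x ≡ φ K C′ y → C ≡ C′} (λ _ → component-of K) φy∈M refl))

  2+t<size : 2 + t < size K C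
  2+t<size = subst (2 + t <_) (≡.sym (odd⇒≡1+2*w (size K C) oddC)) (s≤s 2+t≤2w)

  V-b : Subset n
  V-b = ⊤ ─ ⁅ φ K C b ⁆

  avoids-b : ∀ {u v w y} → ⁅ u ⁆ ∪ ⁅ v ⁆ ∪ ⁅ w ⁆ ⊆ V-b → φ K C y ∈ₗ u ∷ v ∷ w ∷ [] →
             toℕ y ≢ suc t
  avoids-b e⊆ φy∈e y≡1+t = x∈p─q⇒x∉q ⊤ _ (e⊆ (∈-triple⁺ φy∈e))
    (subst (λ z → φ K C z ∈ ⁅ φ K C b ⁆) (toℕ-injective (trans b≡1+t (≡.sym y≡1+t))) (x∈⁅x⁆ _))

  M⊆V-b : M ⊆ V-b
  M⊆V-b = M-elim λ ends → x∈p∧x∉q⇒x∈p─q ∈⊤ λ φy∈b →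
    ends-≢-middle ends (trans (cong toℕ (φ-injective K (x∈⁅y⁆⇒x≡y _ φy∈b))) b≡1+t)

  locate : ∀ {u v w} → Nonempty ((⁅ u ⁆ ∪ ⁅ v ⁆ ∪ ⁅ w ⁆) ∩ M) →
           ∃[ y ] (Ends t (toℕ y) × φ K C y ∈ₗ u ∷ v ∷ w ∷ [])
  locate {u} {v} {w} (x , x∈) with x∈e , x∈M ← x∈p∩q⁻ _ M x∈ =
    M-elim {P = λ x → x ∈ₗ u ∷ v ∷ w ∷ [] → ∃[ y ] (Ends t (toℕ y) × φ K C y ∈ₗ u ∷ v ∷ w ∷ [])}
           (λ ends φy∈ → _ , ends , φy∈) x∈M (∈-triple⁻ x∈e)

  exchange-at-head : ∀ {e y z} {p : Fin (size K C)} → e ≡ ⁅ φ K C p ⁆ ∪ ⁅ y ⁆ ∪ ⁅ z ⁆ →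
    Ends t (toℕ p) → y ∉ M → z ∉ M →
    (∀ {p′} → Ends t (toℕ p′) → BulletEdge K EH (⁅ φ K C p′ ⁆ ∪ ⁅ y ⁆ ∪ ⁅ z ⁆)) →
    Exchangeable (BulletEdge K EH) M e
  exchange-at-head {y = y} {z} e≡ ends y∉M z∉M edge = _ , _ , e≡ , ∈M⁺ ends , yz∩M=∅ , M-elim edge
    where
    yz∩M=∅ : ∀ {x} → x ∈ ⁅ y ⁆ ∪ ⁅ z ⁆ → x ∉ M
    yz∩M=∅ x∈ with ∈-pair⁻ x∈
    ... | inj₁ refl = y∉M
    ... | inj₂ refl = z∉M

  exchange-pattern : ∀ {e} → NonSingleton K C → ∀ {p q r : Fin (size K C)} →
    EvenOddEven (size K C) (toℕ p) (toℕ q) (toℕ r) →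
    e ≡ ⁅ φ K C p ⁆ ∪ ⁅ φ K C q ⁆ ∪ ⁅ φ K C r ⁆ → e ⊆ V-b → Nonempty (e ∩ M) →
    Exchangeable (BulletEdge K EH) M e
  exchange-pattern ns {p} {q} {r} pat refl e⊆ meets with locate meets
  ... | y , ends , here φy≡φp with refl ← φ-injective K φy≡φp
      with pats , ¬q , ¬r ← exchange-first pat (avoids-b e⊆ (there (here refl))) ends =
    exchange-at-head refl ends (∉M-position ¬q) (∉M-position ¬r) λ ends′ →
      cyc C oddC ns _ q r (EvenOddEven⇒U-cycle (pats ends′))
  ... | y , ends , there (here φy≡φq) with refl ← φ-injective K φy≡φq
      with pats , ¬p , ¬r ← exchange-middle pat (avoids-b e⊆ (here refl))
                                  (avoids-b e⊆ (there (there (here refl)))) ends =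
    exchange-at-head (triple-rotate _ _ _) ends (∉M-position ¬r) (∉M-position ¬p) λ ends′ →
      cyc C oddC ns _ r p (U-cycle-rotate (EvenOddEven⇒U-cycle (pats ends′)))
  ... | y , ends , there (there (here φy≡φr)) with refl ← φ-injective K φy≡φr
      with pats , ¬p , ¬q ← exchange-last pat (avoids-b e⊆ (there (here refl))) 2+t<size ends =
    exchange-at-head (trans (triple-rotate _ _ _) (triple-rotate _ _ _)) ends
                     (∉M-position ¬p) (∉M-position ¬q) λ ends′ →
      cyc C oddC ns _ p q (U-cycle-rotate (U-cycle-rotate (EvenOddEven⇒U-cycle (pats ends′))))

  halves : ∀ {y} k → Ends t y → y ≡ 2 * k →
           ∀ {x} → Ends t x → ∃[ k′ ] (x ≡ 2 * k′ × k′ ≤ w (size K C))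
  halves k ends y≡2k = ends-double (ends-even ends (subst Even (≡.sym y≡2k) (even-double k))) 2+t≤2w

  exchange : ∀ {e} → BulletEdge K EH e → e ⊆ V-b → Nonempty (e ∩ M) →
             Exchangeable (BulletEdge K EH) M e
  exchange (cyc C′ _ ns x y z cy) e⊆ meets with locate meets
  ... | _ , _ , φ∈ with ∈-map⁻ (φ K C′) {xs = x ∷ y ∷ z ∷ []} φ∈
  ... | _ , _ , φ≡ with refl ← component-of K φ≡ with U-cycle⇒EvenOddEven cy
  ... | inj₁ xyz        = exchange-pattern ns xyz refl e⊆ meets
  ... | inj₂ (inj₁ yzx) = exchange-pattern ns yzx (triple-rotate _ _ _) e⊆ meets
  ... | inj₂ (inj₂ zxy) =
    exchange-pattern ns zxy (trans (triple-rotate _ _ _) (triple-rotate _ _ _)) e⊆ meets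
  exchange (two C′ D eh evenC′ oddD a′ b′ d′ i j k i≤j j≤ k≤ a′≡ b′≡ d′≡2k) e⊆ meets
    with locate meets
  ... | _ , _ , here φ≡                 = ⊥-elim (oddC (even-size K φ≡ evenC′))
  ... | _ , _ , there (here φ≡)         = ⊥-elim (oddC (even-size K φ≡ evenC′))
  ... | y , ends , there (there (here φ≡)) with refl ← inj K C D y d′ φ≡ =
    exchange-at-head (≡.sym (triple-rotate _ _ _)) ends (∉M-component C′≢C) (∉M-component C′≢C)
      λ ends′ → let k′ , y′≡2k′ , k′≤ = halves k ends d′≡2k ends′ in
        subst (BulletEdge K EH) (≡.sym (triple-rotate _ _ _))
          (two C′ C eh evenC′ oddD a′ b′ _ i j k′ i≤j j≤ k′≤ a′≡ b′≡ y′≡2k′)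
    where
    C′≢C : C′ ≢ C
    C′≢C refl = oddC evenC′
  exchange (three I J L I≢J J≢L I≢L eh a′ b′ d′ i j k i≤ j≤ k≤ a′≡2i b′≡2j d′≡2k) e⊆ meets
    with locate meets
  ... | y , ends , here φ≡ with refl ← inj K C I y a′ φ≡ =
    exchange-at-head refl ends (∉M-component (I≢J ∘ ≡.sym)) (∉M-component (I≢L ∘ ≡.sym))
      λ ends′ → let i′ , y′≡2i′ , i′≤ = halves i ends a′≡2i ends′ in
        three C J L I≢J J≢L I≢L eh _ b′ d′ i′ j k i′≤ j≤ k≤ y′≡2i′ b′≡2j d′≡2k
  ... | y , ends , there (here φ≡) with refl ← inj K C J y b′ φ≡ =
    exchange-at-head (triple-rotate _ _ _) ends (∉M-component (J≢L ∘ ≡.sym)) (∉M-component I≢J)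
      λ ends′ → let j′ , y′≡2j′ , j′≤ = halves j ends b′≡2j ends′ in
        subst (BulletEdge K EH) (triple-rotate _ _ _)
          (three I C L I≢J J≢L I≢L eh a′ _ d′ i j′ k i≤ j′≤ k≤ a′≡2i y′≡2j′ d′≡2k)
  ... | y , ends , there (there (here φ≡)) with refl ← inj K C L y d′ φ≡ =
    exchange-at-head (≡.sym (triple-rotate _ _ _)) ends (∉M-component I≢L) (∉M-component J≢L)
      λ ends′ → let k′ , y′≡2k′ , k′≤ = halves k ends d′≡2k ends′ in
        subst (BulletEdge K EH) (≡.sym (triple-rotate _ _ _))
          (three I J C I≢J J≢L I≢L eh a′ b′ _ i j k′ i≤ j≤ k′≤ a′≡2i b′≡2j y′≡2k′)

  neighbours-module : IsModule (Bullet K EH -ᵥ φ K C b) M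
  neighbours-module = exchangeable⇒module (Bullet K EH) ⁅ φ K C b ⁆ M M⊆V-b exchange

mainTheorem17 :
  ∀ {n c : ℕ} (Γ : Graph n) (K : PathComponents Γ c) → CondN K →
    (EH : Subset c → Set) → Is23 K EH → CondE K EH →
    ∀ (C : Fin c) → Odd (size K C) → NonSingleton K C →
      ((a b : Fin (size K C)) → toℕ a ≡ 0 → toℕ b ≡ 1 →
        IsModule (Bullet K EH -ᵥ φ K C a)
                 (V (Bullet K EH) ─ (⁅ φ K C a ⁆ ∪ ⁅ φ K C b ⁆)))
      ×
      ((a b : Fin (size K C)) →
        toℕ a ≡ 2 * w (size K C) ∸ 1 → toℕ b ≡ 2 * w (size K C) →
        IsModule (Bullet K EH -ᵥ φ K C b)
                 (V (Bullet K EH) ─ (⁅ φ K C a ⁆ ∪ ⁅ φ K C b ⁆)))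
      ×
      (1 ≤ w (size K C) → ∀ (m : ℕ) → 1 ≤ m → m ≤ 2 * w (size K C) ∸ 1 →
        (a b d : Fin (size K C)) →
        toℕ a ≡ m ∸ 1 → toℕ b ≡ m → toℕ d ≡ m + 1 →
        IsModule (Bullet K EH -ᵥ φ K C b) (⁅ φ K C a ⁆ ∪ ⁅ φ K C d ⁆))
mainTheorem17 Γ K _ EH _ _ C oddC ns =
  (λ a b a≡0 b≡1 → complement-module (Bullet K EH) (φ K C a) (φ K C b)
     (cycles-through⇒edges-through K EH oddC (subst Odd (≡.sym b≡1) ¬even-1)
       (positions-through a≡0 b≡1 U-cycle∋1⇒∋0))) ,
  (λ a b a≡ b≡ → subst (IsModule (Bullet K EH -ᵥ φ K C b)) (cong (⊤ ─_) (∪-comm _ _))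
     (complement-module (Bullet K EH) (φ K C b) (φ K C a)
       (cycles-through⇒edges-through K EH oddC (subst Odd (≡.sym a≡) (2*W∸1-odd W 1≤W))
         (positions-through b≡ a≡ (U-cycle∋2*W∸1⇒∋2*W size≡ 1≤W))))) ,
  λ _ → neighbours
  where
  W : ℕ
  W = w (size K C)
  size≡ : size K C ≡ suc (2 * W)
  size≡ = odd⇒≡1+2*w (size K C) oddC
  1≤W : 1 ≤ W
  1≤W = 1+2*W≢1⇒1≤W (ns ∘ trans size≡)
  neighbours : ∀ m → 1 ≤ m → m ≤ 2 * W ∸ 1 → (a b d : Fin (size K C)) →
    toℕ a ≡ m ∸ 1 → toℕ b ≡ m → toℕ d ≡ m + 1 →
    IsModule (Bullet K EH -ᵥ φ K C b) (⁅ φ K C a ⁆ ∪ ⁅ φ K C d ⁆)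
  neighbours (suc t) _ 1+t≤ _ _ _ a≡ b≡ d≡ =
    Neighbours.neighbours-module K EH oddC t a≡ b≡ (trans d≡ (+-comm (suc t) 1))
      (subst (2 + t ≤_) (suc[2*W∸1]≡2*W W 1≤W) (s≤s 1+t≤))
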